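{- Let $k$ be a natural number, $G$ a subcubic multigraph with a Hamiltonian path $H$, and $M=E(G)\setminus E(H)$. If $|M|\geq \frac{8}{3}k(k-1)+1$, then there exists a path $P$ in $G$ such that $|E(P)\cap M|\geq k$.
   Context: A subcubic multigraph is a finite multigraph (parallel edges allowed) in which every vertex has degree at most 3. -}

module Defs where

open import Data.Nat using (ℕ; suc; _≤_)
open import Data.Fin using (Fin; _≟_)
open import Data.Product using (_×_; _,_; proj₁; proj₂; ∃)
open import Data.Sum using (_⊎_)
open import Data.List using (List; []; _∷_; length; filter; allFin)
open import Data.List.Membership.Propositional using (_∈_)
open import Data.List.Relation.Unary.Unique.Propositional using (Unique)
open import Relation.Binary.PropositionalEquality using (_≡_; _≢_)
open import Relation.Nullary using (¬?)
open import Relation.Nullary.Decidable using (_⊎-dec_)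
import Data.List.Membership.DecPropositional as DecMem

-- A finite multigraph (parallel edges allowed, no loops):
-- vertices are Fin n, edges are Fin m, and each edge has two distinct endpoints.
record Multigraph : Set where
  field
    n     : ℕ
    m     : ℕ
    ends  : Fin m → Fin n × Fin n
    loopless : ∀ e → proj₁ (ends e) ≢ proj₂ (ends e)

module _ (G : Multigraph) where
  open Multigraph G

  Incident : Fin m → Fin n → Set
  Incident e v = (proj₁ (ends e) ≡ v) ⊎ (proj₂ (ends e) ≡ v)

  degree : Fin n → ℕ
  degree v = length (filter (λ e → (proj₁ (ends e) ≟ v) ⊎-dec (proj₂ (ends e) ≟ v)) (allFin m))

  Subcubic : Set
  Subcubic = ∀ v → degree v ≤ 3

  Joins : Fin m → Fin n → Fin n → Set
  Joins e u w = (ends e ≡ (u , w)) ⊎ (ends e ≡ (w , u))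

  data WalkFrom (v : Fin n) : List (Fin m) → List (Fin n) → Set where
    stop : WalkFrom v [] (v ∷ [])
    step : ∀ {e w es vs} → Joins e v w → WalkFrom w es vs → WalkFrom v (e ∷ es) (v ∷ vs)

  IsPath : List (Fin m) → List (Fin n) → Set
  IsPath es vs = ∃ (λ v → WalkFrom v es vs) × Unique vs

  IsHamiltonianPath : List (Fin m) → List (Fin n) → Set
  IsHamiltonianPath es vs = IsPath es vs × (∀ u → u ∈ vs)

  -- |E(P) ∩ M| where M = E(G) \ E(H): number of edges of P not in the edge list of H
  countOutside : (hes pes : List (Fin m)) → ℕ
  countOutside hes pes = length (filter (λ e → ¬? (e ∈? hes)) pes)
    where open DecMem (_≟_ {m})

  sizeM : (hes : List (Fin m)) → ℕ
  sizeM hes = countOutside hes (allFin m)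

-- Number the vertices 0, …, L − 1 along the Hamiltonian path and call an edge of M a chord if
-- both its ends are interior vertices. An interior vertex already carries two path edges, so
-- distinct chords have distinct ends, and all but at most four edges of M (those at the two end
-- vertices) are chords. A chord is an interval [lo, hi] of positions. By Mirsky's theorem for the
-- nesting order, more than 8(k − 1)²/3 chords contain either k nested ones, through which a path
-- spirals outwards, or more than 8(k − 1)/3 pairwise non-nested ones. Sorted by left end, the
-- latter fall into blocks of chords starting inside the first chord of their block; a path zigzags
-- through three quarters of a block, and the zigzags of alternate blocks join into two paths, one
-- of which uses three eighths of these chords.

module Submission where

open import Defs
open import Data.Nat using (ℕ; zero; suc; _+_; _*_; _∸_; _≤_; _<_; _<?_; _⊓_; _⊔_; _≤′_; ≤′-step; ≤′-reflexive; z≤n; s≤s)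
open import Data.Nat.Properties hiding (_≟_)
open import Data.Nat.DivMod using (_/_; _%_; m≡m%n+[m/n]*n; m%n<n; m/n*n≤m)
open import Data.Nat.Tactic.RingSolver using (solve-∀)
open import Data.Fin using (Fin; _≟_)
open import Data.Bool.Properties using (T-irrelevant)
open import Data.List using (List; []; _∷_; _++_; [_]; length; head; filter; takeWhile; dropWhile; allFin; map)
open import Data.List.Properties using (++-assoc; length-++; length-map; takeWhile++dropWhile; filter-accept; filter-reject)
open import Data.List.Relation.Unary.All as All using (All; []; _∷_)
import Data.List.Relation.Unary.All.Properties as All
open import Data.List.Relation.Unary.Any as Any using (Any; here; there; any?)
open import Data.List.Relation.Unary.AllPairs using (AllPairs; []; _∷_)
import Data.List.Relation.Unary.AllPairs.Properties as AllPairs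
open import Data.List.Relation.Unary.Linked using (Linked; [-]; _∷_)
open import Data.List.Relation.Unary.Unique.Propositional using (Unique)
import Data.List.Relation.Unary.Unique.Propositional.Properties as Unique
open import Data.List.Membership.Propositional using (_∈_; _∉_; find)
open import Data.List.Membership.Propositional.Properties using (∈-filter⁺; ∈-filter⁻; ∈-allFin)
open import Data.List.Relation.Binary.Subset.Propositional using (_⊆_)
open import Data.Maybe.Relation.Unary.All using (just) renaming (All to AllMaybe)
open import Data.Product using (Σ; ∃; _×_; _,_; proj₁; proj₂)
open import Data.Product.Properties using (,-injectiveˡ; ,-injectiveʳ)
open import Data.Sum using (_⊎_; inj₁; inj₂; map₁; map₂)
open import Function using (_∘_)
open import Level using (0ℓ)
open import Relation.Binary.Definitions using (tri<; tri≈; tri>)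
open import Relation.Binary.PropositionalEquality hiding ([_])
open import Relation.Nullary using (Dec; yes; no; ¬_; contradiction)
open import Relation.Nullary.Decidable using (¬?; _×-dec_; _⊎-dec_; True; toWitness; fromWitness)
open import Relation.Unary using (Pred; Decidable; ∁)

Between : ℕ → ℕ → ℕ → Set
Between a b y = a ≤ y × y < b

unique-++ : ∀ {P Q : ℕ → Set} {xs ys} → Unique xs → Unique ys → All P xs → All Q ys →
            (∀ {x y} → P x → Q y → x ≢ y) → Unique (xs ++ ys)
unique-++ uxs uys pxs qys apart = AllPairs.++⁺ uxs uys (All.map (λ px → All.map (apart px) qys) pxs)

unique-∷ : ∀ {Q : ℕ → Set} {x ys} → Unique ys → All Q ys → (∀ {y} → Q y → x ≢ y) → Unique (x ∷ ys)
unique-∷ uys qys apart = All.map apart qys ∷ uys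

unique-∷ʳ⁻ : ∀ {A : Set} (xs : List A) {y} → Unique (xs ++ [ y ]) → Unique xs × All (_≢ y) xs
unique-∷ʳ⁻ []       _          = [] , []
unique-∷ʳ⁻ (x ∷ xs) (x∉ ∷ u) with unique-∷ʳ⁻ xs u
... | u′ , ≢y = All.++⁻ˡ xs x∉ ∷ u′ , All.head (All.++⁻ʳ xs x∉) ∷ ≢y

AllPairs-++⁻ : ∀ {A : Set} {R : A → A → Set} xs {ys} → AllPairs R (xs ++ ys) →
               AllPairs R xs × AllPairs R ys × All (λ x → All (R x) ys) xs
AllPairs-++⁻ []       Rys         = [] , Rys , []
AllPairs-++⁻ (x ∷ xs) (Rx ∷ Rxys) with AllPairs-++⁻ xs Rxys
... | Rxs , Rys , Rxsys = All.++⁻ˡ xs Rx ∷ Rxs , Rys , All.++⁻ʳ xs Rx ∷ Rxsys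

length-filter+∁ : ∀ {A : Set} {P : Pred A 0ℓ} (P? : Decidable P) xs →
                  length (filter P? xs) + length (filter (¬? ∘ P?) xs) ≡ length xs
length-filter+∁ P? [] = refl
length-filter+∁ P? (x ∷ xs) with P? x
... | yes _ = cong suc (length-filter+∁ P? xs)
... | no  _ = trans (+-suc _ _) (cong suc (length-filter+∁ P? xs))

AllPairs-refine : ∀ {A : Set} {P : A → Set} {R S : A → A → Set} {xs} →
                  (∀ {x y} → P x → P y → R x y → S x y) → All P xs → AllPairs R xs → AllPairs S xs
AllPairs-refine f []         []         = []
AllPairs-refine f (px ∷ pxs) (rx ∷ rxs) = All.zipWith (λ (py , r) → f px py r) (pxs , rx) ∷ AllPairs-refine f pxs rxs

module _ {A : Set} where

  nonempty⇒∈ : ∀ {xs : List A} → 0 < length xs → ∃ (_∈ xs)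
  nonempty⇒∈ {x ∷ _} _ = x , here refl

  nth : A → List A → ℕ → A
  nth d []       _       = d
  nth d (x ∷ xs) zero    = x
  nth d (x ∷ xs) (suc i) = nth d xs i

  nth-∈ : ∀ d xs {i} → i < length xs → nth d xs i ∈ xs
  nth-∈ d (x ∷ xs) {zero}  _         = here refl
  nth-∈ d (x ∷ xs) {suc i} (s≤s i<n) = there (nth-∈ d xs i<n)

  ∈⇒nth : ∀ d {xs u} → u ∈ xs → Σ ℕ λ i → i < length xs × nth d xs i ≡ u
  ∈⇒nth d (here refl) = 0 , s≤s z≤n , refl
  ∈⇒nth d (there u∈xs) with ∈⇒nth d u∈xs
  ... | i , i<n , eq = suc i , s≤s i<n , eq

  nth-injective : ∀ d {xs} → Unique xs → ∀ {i j} → i < length xs → j < length xs → nth d xs i ≡ nth d xs j → i ≡ j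
  nth-injective d {x ∷ xs} _          {zero}  {zero}  _         _         _  = refl
  nth-injective d {x ∷ xs} (x∉ ∷ _)  {zero}  {suc j} _         (s≤s j<n) eq = contradiction eq (All.lookup x∉ (nth-∈ d xs j<n))
  nth-injective d {x ∷ xs} (x∉ ∷ _)  {suc i} {zero}  (s≤s i<n) _         eq = contradiction (sym eq) (All.lookup x∉ (nth-∈ d xs i<n))
  nth-injective d {x ∷ xs} (_ ∷ uxs) {suc i} {suc j} (s≤s i<n) (s≤s j<n) eq = cong suc (nth-injective d uxs i<n j<n eq)

  module _ (_≟ᴬ_ : (x y : A) → Dec (x ≡ y)) where

    remove : A → List A → List A
    remove x [] = []
    remove x (y ∷ ys) with x ≟ᴬ y
    ... | yes _ = ys
    ... | no  _ = y ∷ remove x ys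

    length-remove : ∀ {x} ys → x ∈ ys → suc (length (remove x ys)) ≡ length ys
    length-remove {x} (y ∷ ys) x∈ with x ≟ᴬ y
    length-remove (y ∷ ys) _            | yes _ = refl
    length-remove (y ∷ ys) (here x≡y)   | no x≢y = contradiction x≡y x≢y
    length-remove (y ∷ ys) (there x∈ys) | no _   = cong suc (length-remove ys x∈ys)

    ∈-remove : ∀ {x z} ys → z ∈ ys → z ≢ x → z ∈ remove x ys
    ∈-remove {x} (y ∷ ys) z∈ z≢x with x ≟ᴬ y
    ∈-remove (y ∷ ys) (here refl) z≢x  | yes refl = contradiction refl z≢x
    ∈-remove (y ∷ ys) (there z∈ys) _   | yes _    = z∈ys
    ∈-remove (y ∷ ys) (here z≡y) _     | no _     = here z≡y
    ∈-remove (y ∷ ys) (there z∈ys) z≢x | no _     = there (∈-remove ys z∈ys z≢x)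

    unique-⊆⇒length≤ : ∀ {xs ys} → Unique xs → xs ⊆ ys → length xs ≤ length ys
    unique-⊆⇒length≤ {[]}     _           _  = z≤n
    unique-⊆⇒length≤ {x ∷ xs} {ys} (x∉ ∷ u) xs⊆ =
      subst (suc (length xs) ≤_) (length-remove ys (xs⊆ (here refl)))
        (s≤s (unique-⊆⇒length≤ u (λ z∈xs → ∈-remove ys (xs⊆ (there z∈xs)) (λ z≡x → All.lookup x∉ z∈xs (sym z≡x)))))

  length-filter-∷ : ∀ {P : Pred A 0ℓ} (P? : Decidable P) x xs → length (filter P? xs) ≤ length (filter P? (x ∷ xs))
  length-filter-∷ P? x xs with P? x
  ... | yes _ = n≤1+n _
  ... | no  _ = ≤-refl

  length-filter-⊎ : ∀ {P Q R : Pred A 0ℓ} (P? : Decidable P) (Q? : Decidable Q) (R? : Decidable R) →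
                    (∀ {x} → P x → Q x ⊎ R x) → ∀ xs →
                    length (filter P? xs) ≤ length (filter Q? xs) + length (filter R? xs)
  length-filter-⊎ P? Q? R? P⇒Q⊎R [] = z≤n
  length-filter-⊎ P? Q? R? P⇒Q⊎R (x ∷ xs) with P? x
  ... | no  _  = ≤-trans (length-filter-⊎ P? Q? R? P⇒Q⊎R xs) (+-mono-≤ (length-filter-∷ Q? x xs) (length-filter-∷ R? x xs))
  ... | yes px with P⇒Q⊎R px
  ...   | inj₁ qx rewrite filter-accept Q? {x} {xs} qx =
          s≤s (≤-trans (length-filter-⊎ P? Q? R? P⇒Q⊎R xs) (+-monoʳ-≤ _ (length-filter-∷ R? x xs)))
  ...   | inj₂ rx rewrite filter-accept R? {x} {xs} rx | +-suc (length (filter Q? (x ∷ xs))) (length (filter R? xs)) =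
          s≤s (≤-trans (length-filter-⊎ P? Q? R? P⇒Q⊎R xs) (+-monoˡ-≤ _ (length-filter-∷ Q? x xs)))

-- Routes visit positions 0, 1, 2, … of a path; each step moves to a neighbouring
-- position or jumps along a chord c between the positions lo c < hi c.
module Routes {C : Set} (lo hi : C → ℕ) where

  _⊏_ : C → C → Set
  c ⊏ d = lo d < lo c × hi c < hi d

  _≺_ : C → C → Set
  c ≺ d = lo c < lo d × hi c < hi d

  Outside : C → ℕ → Set
  Outside c y = y ≤ lo c ⊎ hi c ≤ y

  data Route : ℕ → Set where
    stop   : ∀ x → Route x
    up     : ∀ {x} → Route (suc x) → Route x
    down   : ∀ {x} → Route x → Route (suc x)
    chord⁺ : ∀ {x} (c : C) → lo c ≡ x → Route (hi c) → Route x
    chord⁻ : ∀ {x} (c : C) → hi c ≡ x → Route (lo c) → Route x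

  visits : ∀ {x} → Route x → List ℕ
  visits (stop x)           = x ∷ []
  visits {x} (up r)         = x ∷ visits r
  visits {x} (down r)       = x ∷ visits r
  visits {x} (chord⁺ _ _ r) = x ∷ visits r
  visits {x} (chord⁻ _ _ r) = x ∷ visits r

  end : ∀ {x} → Route x → ℕ
  end (stop x)       = x
  end (up r)         = end r
  end (down r)       = end r
  end (chord⁺ _ _ r) = end r
  end (chord⁻ _ _ r) = end r

  chords : ∀ {x} → Route x → ℕ
  chords (stop _)       = 0
  chords (up r)         = chords r
  chords (down r)       = chords r
  chords (chord⁺ _ _ r) = suc (chords r)
  chords (chord⁻ _ _ r) = suc (chords r)

  _++ᴿ_ : ∀ {x} (r : Route x) → Route (end r) → Route x
  stop _ ++ᴿ s       = s
  up r ++ᴿ s         = up (r ++ᴿ s)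
  down r ++ᴿ s       = down (r ++ᴿ s)
  chord⁺ c e r ++ᴿ s = chord⁺ c e (r ++ᴿ s)
  chord⁻ c e r ++ᴿ s = chord⁻ c e (r ++ᴿ s)

  visits⁻ : ∀ {x} → Route x → List ℕ
  visits⁻ (stop _)           = []
  visits⁻ {x} (up r)         = x ∷ visits⁻ r
  visits⁻ {x} (down r)       = x ∷ visits⁻ r
  visits⁻ {x} (chord⁺ _ _ r) = x ∷ visits⁻ r
  visits⁻ {x} (chord⁻ _ _ r) = x ∷ visits⁻ r

  visits-++ᴿ : ∀ {x} (r : Route x) (s : Route (end r)) → visits (r ++ᴿ s) ≡ visits⁻ r ++ visits s
  visits-++ᴿ (stop _) s       = refl
  visits-++ᴿ (up r) s         = cong (_ ∷_) (visits-++ᴿ r s)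
  visits-++ᴿ (down r) s       = cong (_ ∷_) (visits-++ᴿ r s)
  visits-++ᴿ (chord⁺ _ _ r) s = cong (_ ∷_) (visits-++ᴿ r s)
  visits-++ᴿ (chord⁻ _ _ r) s = cong (_ ∷_) (visits-++ᴿ r s)

  visits≡visits⁻∷ʳend : ∀ {x} (r : Route x) → visits r ≡ visits⁻ r ++ [ end r ]
  visits≡visits⁻∷ʳend (stop _)       = refl
  visits≡visits⁻∷ʳend (up r)         = cong (_ ∷_) (visits≡visits⁻∷ʳend r)
  visits≡visits⁻∷ʳend (down r)       = cong (_ ∷_) (visits≡visits⁻∷ʳend r)
  visits≡visits⁻∷ʳend (chord⁺ _ _ r) = cong (_ ∷_) (visits≡visits⁻∷ʳend r)
  visits≡visits⁻∷ʳend (chord⁻ _ _ r) = cong (_ ∷_) (visits≡visits⁻∷ʳend r)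

  end-++ᴿ : ∀ {x} (r : Route x) (s : Route (end r)) → end (r ++ᴿ s) ≡ end s
  end-++ᴿ (stop _) s       = refl
  end-++ᴿ (up r) s         = end-++ᴿ r s
  end-++ᴿ (down r) s       = end-++ᴿ r s
  end-++ᴿ (chord⁺ _ _ r) s = end-++ᴿ r s
  end-++ᴿ (chord⁻ _ _ r) s = end-++ᴿ r s

  chords-++ᴿ : ∀ {x} (r : Route x) (s : Route (end r)) → chords (r ++ᴿ s) ≡ chords r + chords s
  chords-++ᴿ (stop _) s       = refl
  chords-++ᴿ (up r) s         = chords-++ᴿ r s
  chords-++ᴿ (down r) s       = chords-++ᴿ r s
  chords-++ᴿ (chord⁺ _ _ r) s = cong suc (chords-++ᴿ r s)
  chords-++ᴿ (chord⁻ _ _ r) s = cong suc (chords-++ᴿ r s)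

  head-visits : ∀ {x} (r : Route x) {P : ℕ → Set} → All P (visits r) → P x
  head-visits (stop _) (p ∷ _)       = p
  head-visits (up r) (p ∷ _)         = p
  head-visits (down r) (p ∷ _)       = p
  head-visits (chord⁺ _ _ r) (p ∷ _) = p
  head-visits (chord⁻ _ _ r) (p ∷ _) = p

  climb′ : ∀ {a b} → a ≤′ b → Route b → Route a
  climb′ (≤′-reflexive refl) r = r
  climb′ (≤′-step a≤′b) r      = climb′ a≤′b (up r)

  climb : ∀ {a b} → a ≤ b → Route b → Route a
  climb a≤b = climb′ (≤⇒≤′ a≤b)

  descend′ : ∀ {a b} → a ≤′ b → Route a → Route b
  descend′ (≤′-reflexive refl) r = r
  descend′ (≤′-step a≤′b) r      = down (descend′ a≤′b r)

  descend : ∀ {a b} → a ≤ b → Route a → Route b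
  descend a≤b = descend′ (≤⇒≤′ a≤b)

  SpanThen : ℕ → ℕ → List ℕ → List ℕ → Set
  SpanThen a b ys zs = ∃ λ seg → ys ≡ seg ++ zs × Unique seg × All (Between a b) seg

  climb′-visits : ∀ {a b} (a≤′b : a ≤′ b) (r : Route b) → SpanThen a b (visits (climb′ a≤′b r)) (visits r)
  climb′-visits (≤′-reflexive refl) r = [] , refl , [] , []
  climb′-visits {a} (≤′-step {n} a≤′n) r with climb′-visits a≤′n (up r)
  ... | seg , eq , u , inside =
    seg ++ [ n ] , trans eq (sym (++-assoc seg [ n ] (visits r))) ,
    unique-++ {Q = _≡ n} u ([] ∷ []) inside (refl ∷ []) (λ (_ , x<n) y≡n → <⇒≢ (subst (_ <_) (sym y≡n) x<n)) ,
    All.++⁺ (All.map (λ (a≤y , y<n) → a≤y , m<n⇒m<1+n y<n) inside) ((≤′⇒≤ a≤′n , ≤-refl) ∷ [])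

  climb-visits : ∀ {a b} (a≤b : a ≤ b) (r : Route b) → SpanThen a b (visits (climb a≤b r)) (visits r)
  climb-visits a≤b = climb′-visits (≤⇒≤′ a≤b)

  descend′-visits : ∀ {a b} (a≤′b : a ≤′ b) (r : Route a) → SpanThen (suc a) (suc b) (visits (descend′ a≤′b r)) (visits r)
  descend′-visits (≤′-reflexive refl) r = [] , refl , [] , []
  descend′-visits {a} (≤′-step {n} a≤′n) r with descend′-visits a≤′n r
  ... | seg , eq , u , inside =
    suc n ∷ seg , cong (suc n ∷_) eq ,
    unique-∷ u inside (λ (_ , y≤n) → >⇒≢ y≤n) ,
    (s≤s (≤′⇒≤ a≤′n) , ≤-refl) ∷ All.map (λ (a<y , y≤n) → a<y , m<n⇒m<1+n y≤n) inside

  descend-visits : ∀ {a b} (a≤b : a ≤ b) (r : Route a) → SpanThen (suc a) (suc b) (visits (descend a≤b r)) (visits r)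
  descend-visits a≤b = descend′-visits (≤⇒≤′ a≤b)

  climb′-end : ∀ {a b} (a≤′b : a ≤′ b) (r : Route b) → end (climb′ a≤′b r) ≡ end r
  climb′-end (≤′-reflexive refl) r = refl
  climb′-end (≤′-step a≤′n) r      = climb′-end a≤′n (up r)

  climb′-chords : ∀ {a b} (a≤′b : a ≤′ b) (r : Route b) → chords (climb′ a≤′b r) ≡ chords r
  climb′-chords (≤′-reflexive refl) r = refl
  climb′-chords (≤′-step a≤′n) r      = climb′-chords a≤′n (up r)

  descend′-end : ∀ {a b} (a≤′b : a ≤′ b) (r : Route a) → end (descend′ a≤′b r) ≡ end r
  descend′-end (≤′-reflexive refl) r = refl
  descend′-end (≤′-step a≤′n) r      = descend′-end a≤′n r

  descend′-chords : ∀ {a b} (a≤′b : a ≤′ b) (r : Route a) → chords (descend′ a≤′b r) ≡ chords r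
  descend′-chords (≤′-reflexive refl) r = refl
  descend′-chords (≤′-step a≤′n) r      = descend′-chords a≤′n r

  climb-end : ∀ {a b} (a≤b : a ≤ b) (r : Route b) → end (climb a≤b r) ≡ end r
  climb-end a≤b = climb′-end (≤⇒≤′ a≤b)

  climb-chords : ∀ {a b} (a≤b : a ≤ b) (r : Route b) → chords (climb a≤b r) ≡ chords r
  climb-chords a≤b = climb′-chords (≤⇒≤′ a≤b)

  descend-end : ∀ {a b} (a≤b : a ≤ b) (r : Route a) → end (descend a≤b r) ≡ end r
  descend-end a≤b = descend′-end (≤⇒≤′ a≤b)

  descend-chords : ∀ {a b} (a≤b : a ≤ b) (r : Route a) → chords (descend a≤b r) ≡ chords r
  descend-chords a≤b = descend′-chords (≤⇒≤′ a≤b)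

  SimpleRoute : ℕ → ℕ → Set
  SimpleRoute N k = Σ ℕ λ x → Σ (Route x) λ r → Unique (visits r) × All (_< N) (visits r) × k ≤ chords r

  record Confined {x} (r : Route x) : Set where
    field
      distinct : Unique (visits r)
      above    : All (x ≤_) (visits r)
      below    : All (_≤ end r) (visits r)

  _⟶_ : ∀ {x y} (r : Route x) (s : Route y) → end r ≤ y → Route x
  (r ⟶ s) e≤y = r ++ᴿ climb e≤y s

  ⟶-end : ∀ {x y} (r : Route x) (s : Route y) (e≤y : end r ≤ y) → end ((r ⟶ s) e≤y) ≡ end s
  ⟶-end r s e≤y = trans (end-++ᴿ r (climb e≤y s)) (climb-end e≤y s)

  ⟶-chords : ∀ {x y} (r : Route x) (s : Route y) (e≤y : end r ≤ y) → chords ((r ⟶ s) e≤y) ≡ chords r + chords s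
  ⟶-chords r s e≤y = trans (chords-++ᴿ r (climb e≤y s)) (cong (chords r +_) (climb-chords e≤y s))

  ⟶-confined : ∀ {x y} (r : Route x) (s : Route y) (e<y : end r < y) → Confined r → Confined s →
               Confined ((r ⟶ s) (<⇒≤ e<y))
  ⟶-confined {x} {y} r s e<y cr cs with climb-visits (<⇒≤ e<y) s
  ... | seg , eq , u-seg , in-seg = record
    { distinct = subst Unique (sym visits≡)
        (unique-++ u-r′ (unique-++ u-seg (Confined.distinct cs) in-seg (Confined.above cs)
                           (λ (_ , z<y) y≤w → <⇒≢ (<-≤-trans z<y y≤w)))
                   r′<end (All.++⁺ (All.map proj₁ in-seg) (All.map (≤-trans (<⇒≤ e<y)) (Confined.above cs)))
                   (λ z<e e≤w → <⇒≢ (<-≤-trans z<e e≤w)))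
    ; above = subst (All (x ≤_)) (sym visits≡)
        (All.++⁺ (All.++⁻ˡ (visits⁻ r) r-above)
           (All.++⁺ (All.map (λ (e≤z , _) → ≤-trans x≤e e≤z) in-seg)
                    (All.map (λ y≤w → ≤-trans x≤e (≤-trans (<⇒≤ e<y) y≤w)) (Confined.above cs))))
    ; below = subst₂ (λ vs E → All (_≤ E) vs) (sym visits≡) (sym (⟶-end r s (<⇒≤ e<y)))
        (All.++⁺ (All.map (λ z<e → <⇒≤ (<-≤-trans z<e (≤-trans (<⇒≤ e<y) y≤E))) r′<end)
           (All.++⁺ (All.map (λ (_ , z<y) → <⇒≤ (<-≤-trans z<y y≤E)) in-seg) (Confined.below cs))) }
    where
      visits≡ : visits ((r ⟶ s) (<⇒≤ e<y)) ≡ visits⁻ r ++ seg ++ visits s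
      visits≡ = trans (visits-++ᴿ r (climb (<⇒≤ e<y) s)) (cong (visits⁻ r ++_) eq)
      r-above : All (x ≤_) (visits⁻ r ++ [ end r ])
      r-above = subst (All (x ≤_)) (visits≡visits⁻∷ʳend r) (Confined.above cr)
      x≤e : x ≤ end r
      x≤e = All.head (All.++⁻ʳ (visits⁻ r) r-above)
      y≤E : y ≤ end s
      y≤E = head-visits s (Confined.below cs)
      r′-facts = unique-∷ʳ⁻ (visits⁻ r) (subst Unique (visits≡visits⁻∷ʳend r) (Confined.distinct cr))
      u-r′ = proj₁ r′-facts
      r′<end : All (_< end r) (visits⁻ r)
      r′<end = All.zipWith (λ (z≤e , z≢e) → ≤∧≢⇒< z≤e z≢e)
                 (All.++⁻ˡ (visits⁻ r) (subst (All (_≤ end r)) (visits≡visits⁻∷ʳend r) (Confined.below cr)) ,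
                  proj₂ r′-facts)

module Spirals {C : Set} (lo hi : C → ℕ) (lo<hi : ∀ c → lo c < hi c)
               (N : ℕ) (hi<N : ∀ c → hi c < N) where
  open Routes lo hi

  -- The chain is listed innermost first; the spiral winds outwards through all of it.
  mutual
    spiral⁺ : ∀ {c cs} → Linked _⊏_ (c ∷ cs) → Route (lo c)
    spiral⁺ {c} [-]        = chord⁺ c refl (stop (hi c))
    spiral⁺ {c} (c⊏d ∷ ch) = chord⁺ c refl (climb (<⇒≤ (proj₂ c⊏d)) (spiral⁻ ch))

    spiral⁻ : ∀ {c cs} → Linked _⊏_ (c ∷ cs) → Route (hi c)
    spiral⁻ {c} [-]        = chord⁻ c refl (stop (lo c))
    spiral⁻ {c} (c⊏d ∷ ch) = chord⁻ c refl (descend (<⇒≤ (proj₁ c⊏d)) (spiral⁺ ch))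

  mutual
    spiral⁺-chords : ∀ {c cs} (ch : Linked _⊏_ (c ∷ cs)) → chords (spiral⁺ ch) ≡ length (c ∷ cs)
    spiral⁺-chords [-]        = refl
    spiral⁺-chords (c⊏d ∷ ch) =
      cong suc (trans (climb-chords (<⇒≤ (proj₂ c⊏d)) (spiral⁻ ch)) (spiral⁻-chords ch))

    spiral⁻-chords : ∀ {c cs} (ch : Linked _⊏_ (c ∷ cs)) → chords (spiral⁻ ch) ≡ length (c ∷ cs)
    spiral⁻-chords [-]        = refl
    spiral⁻-chords (c⊏d ∷ ch) =
      cong suc (trans (descend-chords (<⇒≤ (proj₁ c⊏d)) (spiral⁺ ch)) (spiral⁺-chords ch))

  SpiralVisits : C → List ℕ → Set
  SpiralVisits c ys = Unique ys × All (Outside c) ys × All (_< N) ys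

  lo<N : ∀ c → lo c < N
  lo<N c = <-trans (lo<hi c) (hi<N c)

  mutual
    spiral⁺-visits : ∀ {c cs} (ch : Linked _⊏_ (c ∷ cs)) → SpiralVisits c (visits (spiral⁺ ch))
    spiral⁺-visits {c} [-] =
      (<⇒≢ (lo<hi c) ∷ []) ∷ [] ∷ [] , inj₁ ≤-refl ∷ inj₂ ≤-refl ∷ [] , lo<N c ∷ hi<N c ∷ []
    spiral⁺-visits {c} {d ∷ _} ((ld<lc , hc<hd) ∷ ch)
      with climb-visits (<⇒≤ hc<hd) (spiral⁻ ch) | spiral⁻-visits ch
    ... | seg , eq , u-seg , in-seg | u , out , bnd rewrite eq =
      unique-∷ (unique-++ u-seg u in-seg out apart) tail-outside lo≢ ,
      inj₁ ≤-refl ∷ All.map weaken tail-outside ,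
      lo<N c ∷ All.++⁺ (All.map (λ (_ , x<hd) → <-trans x<hd (hi<N d)) in-seg) bnd
      where
        apart : ∀ {x y} → Between (hi c) (hi d) x → Outside d y → x ≢ y
        apart (hc≤x , _) (inj₁ y≤ld) = >⇒≢ (≤-<-trans y≤ld (<-trans ld<lc (<-≤-trans (lo<hi c) hc≤x)))
        apart (_ , x<hd) (inj₂ hd≤y) = <⇒≢ (<-≤-trans x<hd hd≤y)
        Outside⁺ : ℕ → Set
        Outside⁺ y = y < lo c ⊎ hi c ≤ y
        widen : ∀ {y} → Outside d y → Outside⁺ y
        widen (inj₁ y≤ld) = inj₁ (≤-<-trans y≤ld ld<lc)
        widen (inj₂ hd≤y) = inj₂ (≤-trans (<⇒≤ hc<hd) hd≤y)
        tail-outside : All Outside⁺ (seg ++ visits (spiral⁻ ch))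
        tail-outside = All.++⁺ (All.map (λ (hc≤x , _) → inj₂ hc≤x) in-seg) (All.map widen out)
        lo≢ : ∀ {y} → Outside⁺ y → lo c ≢ y
        lo≢ (inj₁ y<lc) = >⇒≢ y<lc
        lo≢ (inj₂ hc≤y) = <⇒≢ (<-≤-trans (lo<hi c) hc≤y)
        weaken : ∀ {y} → Outside⁺ y → Outside c y
        weaken = map₁ <⇒≤

    spiral⁻-visits : ∀ {c cs} (ch : Linked _⊏_ (c ∷ cs)) → SpiralVisits c (visits (spiral⁻ ch))
    spiral⁻-visits {c} [-] =
      (>⇒≢ (lo<hi c) ∷ []) ∷ [] ∷ [] , inj₂ ≤-refl ∷ inj₁ ≤-refl ∷ [] , hi<N c ∷ lo<N c ∷ []
    spiral⁻-visits {c} {d ∷ _} ((ld<lc , hc<hd) ∷ ch)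
      with descend-visits (<⇒≤ ld<lc) (spiral⁺ ch) | spiral⁺-visits ch
    ... | seg , eq , u-seg , in-seg | u , out , bnd rewrite eq =
      unique-∷ (unique-++ u-seg u in-seg out apart) tail-outside hi≢ ,
      inj₂ ≤-refl ∷ All.map weaken tail-outside ,
      hi<N c ∷ All.++⁺ (All.map (λ (_ , x≤lc) → ≤-<-trans (≤-pred x≤lc) (lo<N c)) in-seg) bnd
      where
        apart : ∀ {x y} → Between (suc (lo d)) (suc (lo c)) x → Outside d y → x ≢ y
        apart (ld<x , _) (inj₁ y≤ld) = >⇒≢ (≤-<-trans y≤ld ld<x)
        apart (_ , x≤lc) (inj₂ hd≤y) = <⇒≢ (≤-<-trans (≤-pred x≤lc) (<-≤-trans (<-trans (lo<hi c) hc<hd) hd≤y))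
        Outside⁻ : ℕ → Set
        Outside⁻ y = y ≤ lo c ⊎ hi c < y
        widen : ∀ {y} → Outside d y → Outside⁻ y
        widen (inj₁ y≤ld) = inj₁ (≤-trans y≤ld (<⇒≤ ld<lc))
        widen (inj₂ hd≤y) = inj₂ (<-≤-trans hc<hd hd≤y)
        tail-outside : All Outside⁻ (seg ++ visits (spiral⁺ ch))
        tail-outside = All.++⁺ (All.map (λ (_ , x≤lc) → inj₁ (≤-pred x≤lc)) in-seg) (All.map widen out)
        hi≢ : ∀ {y} → Outside⁻ y → hi c ≢ y
        hi≢ (inj₁ y≤lc) = >⇒≢ (≤-<-trans y≤lc (lo<hi c))
        hi≢ (inj₂ hc<y) = <⇒≢ hc<y
        weaken : ∀ {y} → Outside⁻ y → Outside c y
        weaken = map₂ <⇒≤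

Shape : ℕ → ℕ → ℕ → ℕ → ℕ → Set
Shape l H h E y = Between l H y ⊎ (h ≤ y × y ≤ E)

zigzag-visits : ∀ {lJ hJ lK hK lL hL H E segA segB zs} →
  lJ < lK → lK < lL → lL < H → H ≤ hJ → hJ < hK → hK < hL → hL ≤ E →
  Unique segA → All (Between hJ hK) segA → Unique segB → All (Between lK lL) segB →
  Unique zs → All (Shape lL H hL E) zs →
  Unique (lJ ∷ segA ++ hK ∷ segB ++ zs) × All (Shape lJ H hJ E) (lJ ∷ segA ++ hK ∷ segB ++ zs)
zigzag-visits {lJ} {hJ} {lK} {hK} {lL} {hL} {H} {E} {segA} {segB} {zs}
              lJ<lK lK<lL lL<H H≤hJ hJ<hK hK<hL hL≤E uA inA uB inB uZ shZ =
  unique-∷ (unique-++ uA (unique-∷ uBZ BZ-apart-hK hK-apart) inA AKBZ-apart-A A-apart) tail-above-lJ <⇒≢ ,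
  inj₁ (≤-refl , lJ<H) ∷ All.++⁺ (All.map A-shape inA) (K-shape ∷ All.++⁺ (All.map B-shape inB) (All.map widen shZ))
  where
    lJ<H  = <-trans lJ<lK (<-trans lK<lL lL<H)
    lJ<hJ = <-≤-trans lJ<H H≤hJ
    H<hK  = ≤-<-trans H≤hJ hJ<hK
    lL<hL = <-trans lL<H (<-trans H<hK hK<hL)
    hK≤E  = ≤-trans (<⇒≤ hK<hL) hL≤E
    above-lL : ∀ {y} → Shape lL H hL E y → lL ≤ y
    above-lL (inj₁ (lL≤y , _)) = lL≤y
    above-lL (inj₂ (hL≤y , _)) = ≤-trans (<⇒≤ lL<hL) hL≤y
    uBZ : Unique (segB ++ zs)
    uBZ = unique-++ uB uZ inB shZ (λ (_ , x<lL) shy → <⇒≢ (<-≤-trans x<lL (above-lL shy)))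
    BZ-apart-hK : All (λ y → y < hJ ⊎ hK < y) (segB ++ zs)
    BZ-apart-hK = All.++⁺ (All.map (λ (_ , x<lL) → inj₁ (<-≤-trans (<-trans x<lL lL<H) H≤hJ)) inB)
                          (All.map (λ { (inj₁ (_ , y<H)) → inj₁ (<-≤-trans y<H H≤hJ)
                                      ; (inj₂ (hL≤y , _)) → inj₂ (<-≤-trans hK<hL hL≤y) }) shZ)
    hK-apart : ∀ {y} → y < hJ ⊎ hK < y → hK ≢ y
    hK-apart (inj₁ y<hJ) = >⇒≢ (<-trans y<hJ hJ<hK)
    hK-apart (inj₂ hK<y) = <⇒≢ hK<y
    AKBZ-apart-A : All (λ y → y < hJ ⊎ hK ≤ y) (hK ∷ segB ++ zs)
    AKBZ-apart-A = inj₂ ≤-refl ∷ All.map (map₂ <⇒≤) BZ-apart-hK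
    A-apart : ∀ {x y} → Between hJ hK x → y < hJ ⊎ hK ≤ y → x ≢ y
    A-apart (hJ≤x , _) (inj₁ y<hJ) = >⇒≢ (<-≤-trans y<hJ hJ≤x)
    A-apart (_ , x<hK) (inj₂ hK≤y) = <⇒≢ (<-≤-trans x<hK hK≤y)
    tail-above-lJ : All (lJ <_) (segA ++ hK ∷ segB ++ zs)
    tail-above-lJ =
      All.++⁺ (All.map (λ (hJ≤x , _) → <-≤-trans lJ<hJ hJ≤x) inA)
              (<-trans lJ<hJ hJ<hK ∷ All.++⁺ (All.map (λ (lK≤x , _) → <-≤-trans lJ<lK lK≤x) inB)
                                             (All.map (λ shy → <-≤-trans (<-trans lJ<lK lK<lL) (above-lL shy)) shZ))
    A-shape : ∀ {x} → Between hJ hK x → Shape lJ H hJ E x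
    A-shape (hJ≤x , x<hK) = inj₂ (hJ≤x , ≤-trans (<⇒≤ x<hK) hK≤E)
    K-shape : Shape lJ H hJ E hK
    K-shape = inj₂ (<⇒≤ hJ<hK , hK≤E)
    B-shape : ∀ {x} → Between lK lL x → Shape lJ H hJ E x
    B-shape (lK≤x , x<lL) = inj₁ (≤-trans (<⇒≤ lJ<lK) lK≤x , <-trans x<lL lL<H)
    widen : ∀ {y} → Shape lL H hL E y → Shape lJ H hJ E y
    widen (inj₁ (lL≤y , y<H)) = inj₁ (≤-trans (<⇒≤ (<-trans lJ<lK lK<lL)) lL≤y , y<H)
    widen (inj₂ (hL≤y , y≤E)) = inj₂ (≤-trans (<⇒≤ (<-trans hJ<hK hK<hL)) hL≤y , y≤E)

module Zigzags {C : Set} (lo hi : C → ℕ) (lo<hi : ∀ c → lo c < hi c)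
               (N : ℕ) (hi<N : ∀ c → hi c < N) where
  open Routes lo hi

  zigzagChords : ℕ → ℕ
  zigzagChords zero          = 1
  zigzagChords (suc zero)    = 1
  zigzagChords (suc (suc n)) = suc (suc (zigzagChords n))

  -- Through J, K, L, … alternately forwards and backwards; of an even number
  -- of chords the last one is skipped.
  zigzag : ∀ J rest → AllPairs _≺_ (J ∷ rest) → Route (lo J)
  zigzag J []          _ = chord⁺ J refl (stop (hi J))
  zigzag J (_ ∷ [])    _ = chord⁺ J refl (stop (hi J))
  zigzag J (K ∷ L ∷ rest) (((_ , hJ<hK) ∷ _) ∷ ((lK<lL , _) ∷ _) ∷ ≺s) =
    chord⁺ J refl (climb (<⇒≤ hJ<hK) (chord⁻ K refl (climb (<⇒≤ lK<lL) (zigzag L rest ≺s))))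

  -- The zigzag stays in the windows [lo J, H) and [hi J, end r], where H is the end of the
  -- head of the block, before which all chords of the block start.
  record ZigzagInvariant (J : C) (rest : List C) (H : ℕ) (r : Route (lo J)) : Set where
    field
      distinct : Unique (visits r)
      shaped   : All (Shape (lo J) H (hi J) (end r)) (visits r)
      hi≤end   : hi J ≤ end r
      end≡hi   : Any (λ c → end r ≡ hi c) (J ∷ rest)
      count    : chords r ≡ zigzagChords (length rest)

  single-invariant : ∀ {J rest H} → lo J < H → zigzagChords (length rest) ≡ 1 →
                     ZigzagInvariant J rest H (chord⁺ J refl (stop (hi J)))
  single-invariant {J} lJ<H one = record
    { distinct = (<⇒≢ (lo<hi J) ∷ []) ∷ [] ∷ []
    ; shaped   = inj₁ (≤-refl , lJ<H) ∷ inj₂ (≤-refl , ≤-refl) ∷ []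
    ; hi≤end   = ≤-refl
    ; end≡hi   = here refl
    ; count    = sym one }

  zigzag-invariant : ∀ J rest (≺s : AllPairs _≺_ (J ∷ rest)) H → All (λ c → lo c < H) (J ∷ rest) → H ≤ hi J →
                     ZigzagInvariant J rest H (zigzag J rest ≺s)
  zigzag-invariant J []       _ H (lJ<H ∷ _) _ = single-invariant lJ<H refl
  zigzag-invariant J (_ ∷ []) _ H (lJ<H ∷ _) _ = single-invariant lJ<H refl
  zigzag-invariant J (K ∷ L ∷ rest) ≺all@(((lJ<lK , hJ<hK) ∷ (_ , hJ<hL) ∷ _) ∷ ((lK<lL , hK<hL) ∷ _) ∷ ≺s)
                   H (_ ∷ _ ∷ lL<H ∷ l<H) H≤hJ
    with zigzag-invariant L rest ≺s H (lL<H ∷ l<H) (≤-trans H≤hJ (<⇒≤ hJ<hL))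
       | climb-visits (<⇒≤ hJ<hK) (chord⁻ K refl (climb (<⇒≤ lK<lL) (zigzag L rest ≺s)))
       | climb-visits (<⇒≤ lK<lL) (zigzag L rest ≺s)
  ... | inv | segA , eqA , uA , inA | segB , eqB , uB , inB = record
    { distinct = subst Unique (sym visits≡) (proj₁ visits-shape)
    ; shaped   = subst₂ (λ vs E → All (Shape (lo J) H (hi J) E) vs) (sym visits≡) (sym end≡)
                        (proj₂ visits-shape)
    ; hi≤end   = subst (hi J ≤_) (sym end≡) (≤-trans (<⇒≤ hJ<hL) (ZigzagInvariant.hi≤end inv))
    ; end≡hi   = subst (λ e → Any (λ c → e ≡ hi c) (J ∷ K ∷ L ∷ rest)) (sym end≡)
                        (there (there (ZigzagInvariant.end≡hi inv)))
    ; count    = cong suc (trans (climb-chords (<⇒≤ hJ<hK) _)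
                   (cong suc (trans (climb-chords (<⇒≤ lK<lL) Z) (ZigzagInvariant.count inv)))) }
    where
      Z = zigzag L rest ≺s
      visits≡ : visits (zigzag J (K ∷ L ∷ rest) ≺all) ≡ lo J ∷ segA ++ hi K ∷ segB ++ visits Z
      visits≡ = cong (lo J ∷_) (trans eqA (cong (segA ++_) (cong (hi K ∷_) eqB)))
      end≡ : end (zigzag J (K ∷ L ∷ rest) ≺all) ≡ end Z
      end≡ = trans (climb-end (<⇒≤ hJ<hK) _) (climb-end (<⇒≤ lK<lL) Z)
      visits-shape = zigzag-visits lJ<lK lK<lL lL<H H≤hJ hJ<hK hK<hL (ZigzagInvariant.hi≤end inv)
                    uA inA uB inB (ZigzagInvariant.distinct inv) (ZigzagInvariant.shaped inv)

  n≤zigzagChords : ∀ n → n ≤ zigzagChords n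
  n≤zigzagChords zero          = z≤n
  n≤zigzagChords (suc zero)    = ≤-refl
  n≤zigzagChords (suc (suc n)) = s≤s (s≤s (n≤zigzagChords n))

  1≤zigzagChords : ∀ n → 1 ≤ zigzagChords n
  1≤zigzagChords zero          = ≤-refl
  1≤zigzagChords (suc zero)    = ≤-refl
  1≤zigzagChords (suc (suc n)) = s≤s z≤n

  -- a block of two chords, where zigzag uses only one, is covered by twoChords instead
  zigzagChords-bound : ∀ n → n ≢ 1 → 3 * suc n ≤ 4 * zigzagChords n
  zigzagChords-bound zero          _   = s≤s (s≤s (s≤s z≤n))
  zigzagChords-bound (suc zero)    n≢1 = contradiction refl n≢1
  zigzagChords-bound (suc (suc n)) _   = begin
    3 * suc (suc (suc n))                       ≡⟨ expand n ⟩
    8 + (3 * n + 1)                             ≤⟨ +-monoʳ-≤ 8 (+-mono-≤ (*-monoʳ-≤ 3 (n≤zigzagChords n))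
                                                                        (1≤zigzagChords n)) ⟩
    8 + (3 * zigzagChords n + zigzagChords n)   ≡⟨ collect (zigzagChords n) ⟩
    4 * zigzagChords (suc (suc n))              ∎
    where
      open ≤-Reasoning
      expand : ∀ n → 3 * suc (suc (suc n)) ≡ 8 + (3 * n + 1)
      expand = solve-∀
      collect : ∀ z → 8 + (3 * z + z) ≡ 4 * suc (suc z)
      collect = solve-∀

  twoChords : ∀ J K → lo K < hi J → Route (lo J)
  twoChords J K lK<hJ = chord⁺ J refl (descend (<⇒≤ lK<hJ) (chord⁺ K refl (stop (hi K))))

  record Block (J : C) (B : List C) : Set where
    field
      route    : Route (lo J)
      confined : Confined route
      end≡hi   : Any (λ c → end route ≡ hi c) (J ∷ B)
      count    : 3 * length (J ∷ B) ≤ 4 * chords route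

  twoChords-block : ∀ J K → J ≺ K → (lK<hJ : lo K < hi J) → Block J (K ∷ [])
  twoChords-block J K (lJ<lK , hJ<hK) lK<hJ with descend-visits (<⇒≤ lK<hJ) (chord⁺ K refl (stop (hi K)))
  ... | seg , eq , u-seg , in-seg = record
    { route    = twoChords J K lK<hJ
    ; confined = record
        { distinct = subst Unique (sym visits≡)
            (unique-∷ (unique-++ u-seg ((<⇒≢ (lo<hi K) ∷ []) ∷ [] ∷ []) in-seg K-outside seg-apart)
                      (All.++⁺ (All.map (λ (lK<x , _) → <-trans lJ<lK lK<x) in-seg) (lJ<lK ∷ lJ<hK ∷ []))
                      <⇒≢)
        ; above = subst (All (lo J ≤_)) (sym visits≡)
            (≤-refl ∷ All.++⁺ (All.map (λ (lK<x , _) → <⇒≤ (<-trans lJ<lK lK<x)) in-seg)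
                              (<⇒≤ lJ<lK ∷ <⇒≤ lJ<hK ∷ []))
        ; below = subst₂ (λ vs E → All (_≤ E) vs) (sym visits≡) (sym end≡)
            (<⇒≤ lJ<hK ∷ All.++⁺ (All.map (λ (_ , x≤hJ) → ≤-trans (≤-pred x≤hJ) (<⇒≤ hJ<hK)) in-seg)
                                 (<⇒≤ (lo<hi K) ∷ ≤-refl ∷ [])) }
    ; end≡hi   = subst (λ e → Any (λ c → e ≡ hi c) (J ∷ K ∷ [])) (sym end≡) (there (here refl))
    ; count    = subst (λ n → 6 ≤ 4 * n) (sym chords≡) (*-monoʳ-≤ 2 (n≤1+n 3)) }
    where
      lJ<hK = <-trans lJ<lK (lo<hi K)
      K-outside : All (Outside K) (lo K ∷ hi K ∷ [])
      K-outside = inj₁ ≤-refl ∷ inj₂ ≤-refl ∷ []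
      seg-apart : ∀ {x y} → Between (suc (lo K)) (suc (hi J)) x → Outside K y → x ≢ y
      seg-apart (lK<x , _) (inj₁ y≤lK) = >⇒≢ (≤-<-trans y≤lK lK<x)
      seg-apart (_ , x≤hJ) (inj₂ hK≤y) = <⇒≢ (<-≤-trans (≤-<-trans (≤-pred x≤hJ) hJ<hK) hK≤y)
      visits≡ : visits (twoChords J K lK<hJ) ≡ lo J ∷ seg ++ lo K ∷ hi K ∷ []
      visits≡ = cong (lo J ∷_) eq
      end≡ : end (twoChords J K lK<hJ) ≡ hi K
      end≡ = descend-end (<⇒≤ lK<hJ) (chord⁺ K refl (stop (hi K)))
      chords≡ : chords (twoChords J K lK<hJ) ≡ 2
      chords≡ = cong suc (descend-chords (<⇒≤ lK<hJ) (chord⁺ K refl (stop (hi K))))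

  zigzag-block : ∀ J B (≺s : AllPairs _≺_ (J ∷ B)) → All (λ c → lo c < hi J) B → length B ≢ 1 → Block J B
  zigzag-block J B ≺s lo<hJ |B|≢1 = record
    { route    = zigzag J B ≺s
    ; confined = record
        { distinct = ZigzagInvariant.distinct inv
        ; above    = All.map above (ZigzagInvariant.shaped inv)
        ; below    = All.map below (ZigzagInvariant.shaped inv) }
    ; end≡hi   = ZigzagInvariant.end≡hi inv
    ; count    = subst (λ n → 3 * length (J ∷ B) ≤ 4 * n) (sym (ZigzagInvariant.count inv))
                       (zigzagChords-bound (length B) |B|≢1) }
    where
      inv = zigzag-invariant J B ≺s (hi J) (lo<hi J ∷ lo<hJ) ≤-refl
      E = end (zigzag J B ≺s)
      above : ∀ {y} → Shape (lo J) (hi J) (hi J) E y → lo J ≤ y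
      above (inj₁ (lJ≤y , _)) = lJ≤y
      above (inj₂ (hJ≤y , _)) = ≤-trans (<⇒≤ (lo<hi J)) hJ≤y
      below : ∀ {y} → Shape (lo J) (hi J) (hi J) E y → y ≤ E
      below (inj₁ (_ , y<hJ)) = ≤-trans (<⇒≤ y<hJ) (ZigzagInvariant.hi≤end inv)
      below (inj₂ (_ , y≤E))  = y≤E

  block : ∀ J B → AllPairs _≺_ (J ∷ B) → All (λ c → lo c < hi J) B → Block J B
  block J (K ∷ [])    ((J≺K ∷ []) ∷ _) (lK<hJ ∷ []) = twoChords-block J K J≺K lK<hJ
  block J []          ≺s lo<hJ = zigzag-block J [] ≺s lo<hJ (λ ())
  block J (_ ∷ _ ∷ B) ≺s lo<hJ = zigzag-block J _ ≺s lo<hJ (λ ())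

  record RouteAfter (lb : ℕ) : Set where
    field
      {start}  : ℕ
      route    : Route start
      lb≤start : lb ≤ start
      confined : Confined route
      end<N    : end route < N

  open RouteAfter

  weaken : ∀ {lb lb′} → lb′ ≤ lb → RouteAfter lb → RouteAfter lb′
  weaken lb′≤lb r = record { route = route r ; lb≤start = ≤-trans lb′≤lb (lb≤start r)
                            ; confined = confined r ; end<N = end<N r }

  idle : ∀ c → RouteAfter (hi c)
  idle c = record
    { route = stop (hi c) ; lb≤start = ≤-refl
    ; confined = record { distinct = [] ∷ [] ; above = ≤-refl ∷ [] ; below = ≤-refl ∷ [] }
    ; end<N = hi<N c }

  end≡hi⇒<N : ∀ {cs x} → Any (λ c → x ≡ hi c) cs → x < N
  end≡hi⇒<N (here refl)  = hi<N _
  end≡hi⇒<N (there x≡hi) = end≡hi⇒<N x≡hi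

  end≡hi⇒< : ∀ {d cs x} → Any (λ c → x ≡ hi c) cs → All (_≺ d) cs → x < hi d
  end≡hi⇒< (here refl)  ((_ , hc<hd) ∷ _) = hc<hd
  end≡hi⇒< (there x≡hi) (_ ∷ ≺d)          = end≡hi⇒< x≡hi ≺d

  -- Cut h ∷ T into blocks, each a chord with the following chords that start
  -- before it ends; the blocks alternately go into two routes.
  record TwoRoutes (h : C) (n : ℕ) : Set where
    field
      fromHead : RouteAfter (lo h)
      pastHead : RouteAfter (hi h)
      count    : 3 * n ≤ 4 * (chords (route fromHead) + chords (route pastHead))

  twoRoutes : ∀ fuel h T → length T < fuel → AllPairs _≺_ (h ∷ T) → TwoRoutes h (length (h ∷ T))
  twoRoutes (suc fuel) h T (s≤s |T|≤fuel) (h≺T ∷ ≺T) =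
    subst (TwoRoutes h) (cong suc (sym |T|≡))
      (afterBlock (block h B (h≺B ∷ ≺B) (All.all-takeWhile starts-inside? T))
                  R ≺R (h≺R ∷ B≺R) |R|≤fuel (All.all-head-dropWhile starts-inside? T))
    where
      starts-inside? = λ c → lo c <? hi h
      B = takeWhile starts-inside? T
      R = dropWhile starts-inside? T
      T≡ : T ≡ B ++ R
      T≡ = sym (takeWhile++dropWhile starts-inside? T)
      |T|≡ : length T ≡ length B + length R
      |T|≡ = trans (cong length T≡) (length-++ B)
      |R|≤fuel : length R ≤ fuel
      |R|≤fuel = ≤-trans (m≤n+m (length R) (length B)) (≤-trans (≤-reflexive (sym |T|≡)) |T|≤fuel)
      split = AllPairs-++⁻ B (subst (AllPairs _≺_) T≡ ≺T)
      ≺B = proj₁ split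
      ≺R = proj₁ (proj₂ split)
      B≺R = proj₂ (proj₂ split)
      h≺B = All.++⁻ˡ B (subst (All (h ≺_)) T≡ h≺T)
      h≺R = All.++⁻ʳ B (subst (All (h ≺_)) T≡ h≺T)

      afterBlock : Block h B → ∀ R → AllPairs _≺_ R → All (λ b → All (b ≺_) R) (h ∷ B) → length R ≤ fuel →
                   AllMaybe (∁ (λ c → lo c < hi h)) (head R) → TwoRoutes h (suc (length B + length R))
      afterBlock blk [] _ _ _ _ = record
        { fromHead = record { route = Block.route blk ; lb≤start = ≤-refl ; confined = Block.confined blk
                            ; end<N = end≡hi⇒<N (Block.end≡hi blk) }
        ; pastHead = idle h
        ; count    = subst₂ (λ n m → 3 * suc n ≤ 4 * m) (sym (+-identityʳ (length B)))
                            (sym (+-identityʳ (chords (Block.route blk)))) (Block.count blk) }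
      afterBlock blk (h₂ ∷ R′) ≺R B≺R |R′|<fuel (just lo≮hi) = record
        { fromHead = record
            { route    = joined
            ; lb≤start = ≤-refl
            ; confined = ⟶-confined (Block.route blk) (route E₂) end<start (Block.confined blk) (confined E₂)
            ; end<N    = subst (_< N) (sym (⟶-end (Block.route blk) (route E₂) (<⇒≤ end<start))) (end<N E₂) }
        ; pastHead = weaken (≮⇒≥ lo≮hi) O₂
        ; count    = begin
            3 * suc (length B + suc (length R′))           ≡⟨ split-sum (length B) (length R′) ⟩
            3 * length (h ∷ B) + 3 * length (h₂ ∷ R′)      ≤⟨ +-mono-≤ (Block.count blk) (TwoRoutes.count rest) ⟩
            4 * cB + 4 * (chords (route O₂) + cE₂)         ≡⟨ regroup cB (chords (route O₂)) cE₂ ⟩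
            4 * ((cB + cE₂) + chords (route O₂))           ≡⟨ cong (λ n → 4 * (n + chords (route O₂))) joined-chords ⟩
            4 * (chords joined + chords (route O₂))        ∎ }
        where
          open ≤-Reasoning hiding (start)
          rest = twoRoutes fuel h₂ R′ |R′|<fuel ≺R
          O₂ = TwoRoutes.fromHead rest
          E₂ = TwoRoutes.pastHead rest
          cB = chords (Block.route blk)
          cE₂ = chords (route E₂)
          end<start : end (Block.route blk) < start E₂
          end<start = <-≤-trans (end≡hi⇒< (Block.end≡hi blk) (All.map All.head B≺R)) (lb≤start E₂)
          joined = (Block.route blk ⟶ route E₂) (<⇒≤ end<start)
          joined-chords : cB + cE₂ ≡ chords joined
          joined-chords = sym (⟶-chords (Block.route blk) (route E₂) (<⇒≤ end<start))
          split-sum : ∀ b r → 3 * suc (b + suc r) ≡ 3 * suc b + 3 * suc r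
          split-sum = solve-∀
          regroup : ∀ b o e → 4 * b + 4 * (o + e) ≡ 4 * ((b + e) + o)
          regroup = solve-∀

  simple : ∀ {lb k} (r : RouteAfter lb) → k ≤ chords (route r) → SimpleRoute N k
  simple r k≤ = start r , route r , Confined.distinct (confined r) ,
                All.map (λ y≤end → ≤-<-trans y≤end (end<N r)) (Confined.below (confined r)) , k≤

  larger-half : ∀ n {a b} → 3 * n ≤ 4 * (a + b) → a ≤ b → 3 * n ≤ 8 * b
  larger-half n {a} {b} 3n≤ a≤b = ≤-trans 3n≤ (≤-trans (*-monoʳ-≤ 4 (+-monoˡ-≤ b a≤b)) (≤-reflexive (double b)))
    where
      double : ∀ b → 4 * (b + b) ≡ 8 * b
      double = solve-∀

  nonNested-route : ∀ cs → AllPairs _≺_ cs → ∀ j → 8 * j < 3 * length cs → SimpleRoute N (suc j)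
  nonNested-route (h ∷ T) ≺s j 8j<3n with twoRoutes (suc (length T)) h T ≤-refl ≺s
  ... | record { fromHead = O ; pastHead = E ; count = 3n≤ } with ≤-total (chords (route O)) (chords (route E))
  ...   | inj₁ o≤e = simple E (*-cancelˡ-< 8 j _ (<-≤-trans 8j<3n (larger-half n 3n≤ o≤e)))
    where n = length (h ∷ T)
  ...   | inj₂ e≤o = simple O (*-cancelˡ-< 8 j _ (<-≤-trans 8j<3n (larger-half n 3n≤′ e≤o)))
    where
      n = length (h ∷ T)
      3n≤′ = subst (λ s → 3 * n ≤ 4 * s) (+-comm (chords (route O)) (chords (route E))) 3n≤

module Dichotomy {C : Set} (lo hi : C → ℕ)
                 (lo-injective : ∀ {c d} → lo c ≡ lo d → c ≡ d) (hi-injective : ∀ {c d} → hi c ≡ hi d → c ≡ d) where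

  open Routes lo hi

  Comparable : C → C → Set
  Comparable c d = c ≺ d ⊎ d ≺ c

  ≺-trans : ∀ {a b c} → a ≺ b → b ≺ c → a ≺ c
  ≺-trans (l₁ , h₁) (l₂ , h₂) = <-trans l₁ l₂ , <-trans h₁ h₂

  insert : C → List C → List C
  insert c []      = c ∷ []
  insert c (d ∷ S) with lo c <? lo d
  ... | yes _ = c ∷ d ∷ S
  ... | no  _ = d ∷ insert c S

  insert-All : ∀ {P : C → Set} {c} S → P c → All P S → All P (insert c S)
  insert-All []      pc []         = pc ∷ []
  insert-All {c = c} (d ∷ S) pc (pd ∷ pS) with lo c <? lo d
  ... | yes _ = pc ∷ pd ∷ pS
  ... | no  _ = pd ∷ insert-All S pc pS

  insert-length : ∀ c S → length (insert c S) ≡ suc (length S)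
  insert-length c []      = refl
  insert-length c (d ∷ S) with lo c <? lo d
  ... | yes _ = refl
  ... | no  _ = cong suc (insert-length c S)

  insert-sorted : ∀ c S → AllPairs _≺_ S → All (Comparable c) S → AllPairs _≺_ (insert c S)
  insert-sorted c []      [] []                  = [] ∷ []
  insert-sorted c (d ∷ S) (d≺S ∷ ≺S) (c~d ∷ c~S) with lo c <? lo d | c~d
  ... | yes _     | inj₁ c≺d = (c≺d ∷ All.map (≺-trans c≺d) d≺S) ∷ d≺S ∷ ≺S
  ... | yes lc<ld | inj₂ (ld<lc , _) = contradiction lc<ld (<⇒≯ ld<lc)
  ... | no  lc≮ld | inj₁ (lc<ld , _) = contradiction lc<ld lc≮ld
  ... | no  _     | inj₂ d≺c = insert-All S d≺c d≺S ∷ insert-sorted c S ≺S c~S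

  sort : List C → List C
  sort []      = []
  sort (c ∷ S) = insert c (sort S)

  sort-All : ∀ {P : C → Set} S → All P S → All P (sort S)
  sort-All []      []         = []
  sort-All (c ∷ S) (pc ∷ pS) = insert-All (sort S) pc (sort-All S pS)

  sort-length : ∀ S → length (sort S) ≡ length S
  sort-length []      = refl
  sort-length (c ∷ S) = trans (insert-length c (sort S)) (cong suc (sort-length S))

  sort-sorted : ∀ S → AllPairs Comparable S → AllPairs _≺_ (sort S)
  sort-sorted []      []           = []
  sort-sorted (c ∷ S) (c~S ∷ ~S) = insert-sorted c (sort S) (sort-sorted S ~S) (sort-All S c~S)

  Encloses : List C → C → Set
  Encloses G c = Any (_⊏ c) G

  encloses? : ∀ G → Decidable (Encloses G)
  encloses? G c = any? (λ d → (lo c <? lo d) ×-dec (hi d <? hi c)) G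

  minimal inner : List C → List C
  minimal G = filter (¬? ∘ encloses? G) G
  inner   G = filter (encloses? G) G

  minimal-in : ∀ G → All (λ c → c ∈ G × ¬ Encloses G c) (minimal G)
  minimal-in G = All.tabulate (∈-filter⁻ (¬? ∘ encloses? G))

  minimal⇒comparable : ∀ {G c d} → c ∈ G × ¬ Encloses G c → d ∈ G × ¬ Encloses G d → c ≢ d → Comparable c d
  minimal⇒comparable {c = c} {d} (c∈G , c-min) (d∈G , d-min) c≢d
    with <-cmp (lo c) (lo d) | <-cmp (hi c) (hi d)
  ... | tri≈ _ lc≡ld _ | _              = contradiction (lo-injective lc≡ld) c≢d
  ... | _              | tri≈ _ hc≡hd _ = contradiction (hi-injective hc≡hd) c≢d
  ... | tri< lc<ld _ _ | tri< hc<hd _ _ = inj₁ (lc<ld , hc<hd)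
  ... | tri> _ _ ld<lc | tri> _ _ hd<hc = inj₂ (ld<lc , hd<hc)
  ... | tri< lc<ld _ _ | tri> _ _ hd<hc = contradiction (Any.map (λ { refl → lc<ld , hd<hc }) d∈G) c-min
  ... | tri> _ _ ld<lc | tri< hc<hd _ _ = contradiction (Any.map (λ { refl → ld<lc , hc<hd }) c∈G) d-min

  minimal-comparable : ∀ G → Unique G → AllPairs Comparable (minimal G)
  minimal-comparable G uG =
    AllPairs-refine minimal⇒comparable (minimal-in G) (Unique.filter⁺ (¬? ∘ encloses? G) uG)

  NestedChain : List C → ℕ → Set
  NestedChain G n = Σ (List C) λ ch → Linked _⊏_ ch × length ch ≡ n × All (_∈ G) ch

  SortedFamily : ℕ → Set
  SortedFamily n = Σ (List C) λ S → AllPairs _≺_ S × n ≤ length S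

  -- Mirsky's dual of Dilworth's theorem for the nesting order: peel off the minimal chords.
  dichotomy : ∀ j q G → Unique G → j * q < length G → NestedChain G (suc j) ⊎ SortedFamily (suc q)
  dichotomy zero q (g ∷ G) _ _ = inj₁ (g ∷ [] , [-] , refl , here refl ∷ [])
  dichotomy (suc j) q G uG |G|> with q <? length (minimal G)
  ... | yes q<|min| = inj₂ (sort (minimal G) , sort-sorted (minimal G) (minimal-comparable G uG) ,
                            subst (q <_) (sym (sort-length (minimal G))) q<|min|)
  ... | no  q≮|min| with dichotomy j q (inner G) (Unique.filter⁺ (encloses? G) uG) |inner|>
    where
      |inner|> : j * q < length (inner G)
      |inner|> = +-cancelˡ-< q (j * q) (length (inner G)) (begin-strict
        q + j * q                                   <⟨ |G|> ⟩
        length G                                    ≡⟨ sym (length-filter+∁ (encloses? G) G) ⟩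
        length (inner G) + length (minimal G)       ≤⟨ +-monoʳ-≤ (length (inner G)) (≮⇒≥ q≮|min|) ⟩
        length (inner G) + q                        ≡⟨ +-comm (length (inner G)) q ⟩
        q + length (inner G)                        ∎)
        where open ≤-Reasoning
  ... | inj₂ family = inj₂ family
  ... | inj₁ (c ∷ ch , linked , |ch| , ch∈inner@(c∈inner ∷ _))
    with find (proj₂ (∈-filter⁻ (encloses? G) {xs = G} c∈inner))
  ... | d , d∈G , d⊏c =
    inj₁ (d ∷ c ∷ ch , d⊏c ∷ linked , cong suc |ch| ,
          d∈G ∷ All.map (proj₁ ∘ ∈-filter⁻ (encloses? G) {xs = G}) ch∈inner)

third-of : ∀ a → 3 * (a / 3) ≤ a × a < 3 * suc (a / 3)
third-of a =
  subst (_≤ a) (*-comm (a / 3) 3) (m/n*n≤m a 3) ,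
  (begin-strict
    a                        ≡⟨ m≡m%n+[m/n]*n a 3 ⟩
    a % 3 + a / 3 * 3        <⟨ +-monoˡ-< (a / 3 * 3) (m%n<n a 3) ⟩
    3 + a / 3 * 3            ≡⟨ cong (3 +_) (*-comm (a / 3) 3) ⟩
    3 + 3 * (a / 3)          ≡⟨ sym (*-suc 3 (a / 3)) ⟩
    3 * suc (a / 3)          ∎)
  where open ≤-Reasoning

module ManyChords {C : Set} (lo hi : C → ℕ) (lo<hi : ∀ c → lo c < hi c) (N : ℕ) (hi<N : ∀ c → hi c < N)
                   (lo-injective : ∀ {c d} → lo c ≡ lo d → c ≡ d) (hi-injective : ∀ {c d} → hi c ≡ hi d → c ≡ d) where
  open Routes lo hi
  open Spirals lo hi lo<hi N hi<N
  open Zigzags lo hi lo<hi N hi<N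
  open Dichotomy lo hi lo-injective hi-injective

  chord-route : ∀ j cs → Unique cs → 8 * (j * j) < 3 * length cs → SimpleRoute N (suc j)
  chord-route j cs u 8j²<3n with dichotomy j q cs u jq<n
    where
      q = (8 * j) / 3
      jq<n : j * q < length cs
      jq<n = *-cancelˡ-< 3 (j * q) (length cs) (begin-strict
        3 * (j * q)     ≡⟨ x*[y*z]≡y*[x*z] 3 j q ⟩
        j * (3 * q)     ≤⟨ *-monoʳ-≤ j (proj₁ (third-of (8 * j))) ⟩
        j * (8 * j)     ≡⟨ x*[y*z]≡y*[x*z] j 8 j ⟩
        8 * (j * j)     <⟨ 8j²<3n ⟩
        3 * length cs   ∎)
        where
          open ≤-Reasoning
          x*[y*z]≡y*[x*z] : ∀ x y z → x * (y * z) ≡ y * (x * z)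
          x*[y*z]≡y*[x*z] = solve-∀
  ... | inj₁ (c ∷ cs′ , nested , |ch| , _) =
    lo c , spiral⁺ nested , proj₁ (spiral⁺-visits nested) , proj₂ (proj₂ (spiral⁺-visits nested)) ,
    ≤-reflexive (sym (trans (spiral⁺-chords nested) |ch|))
  ... | inj₂ (S , sorted , q<|S|) = nonNested-route S sorted j (<-≤-trans (proj₂ (third-of (8 * j))) (*-monoʳ-≤ 3 q<|S|))

PathThroughM : (G : Multigraph) → List (Fin (Multigraph.m G)) → ℕ → Set
PathThroughM G hes k = Σ (List (Fin (Multigraph.m G))) λ pes → Σ (List (Fin (Multigraph.n G))) λ pvs →
                       IsPath G pes pvs × k ≤ countOutside G hes pes

module Walks (G : Multigraph) where
  open Multigraph G

  Joins-sym : ∀ {e u w} → Joins G e u w → Joins G e w u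
  Joins-sym (inj₁ eq) = inj₂ eq
  Joins-sym (inj₂ eq) = inj₁ eq

  Joins⇒Incident : ∀ {e u w} → Joins G e u w → Incident G e u × Incident G e w
  Joins⇒Incident (inj₁ eq) = inj₁ (cong proj₁ eq) , inj₂ (cong proj₂ eq)
  Joins⇒Incident (inj₂ eq) = inj₂ (cong proj₂ eq) , inj₁ (cong proj₁ eq)

  Joins-twice : ∀ {e x y z} → Joins G e x y → Joins G e y z → x ≡ y ⊎ x ≡ z ⊎ y ≡ z
  Joins-twice (inj₁ e≡xy) (inj₁ e≡yz) = inj₁ (,-injectiveˡ (trans (sym e≡xy) e≡yz))
  Joins-twice (inj₁ e≡xy) (inj₂ e≡zy) = inj₂ (inj₁ (,-injectiveˡ (trans (sym e≡xy) e≡zy)))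
  Joins-twice (inj₂ e≡yx) (inj₁ e≡yz) = inj₂ (inj₁ (,-injectiveʳ (trans (sym e≡yx) e≡yz)))
  Joins-twice (inj₂ e≡yx) (inj₂ e≡zy) = inj₂ (inj₂ (,-injectiveˡ (trans (sym e≡yx) e≡zy)))

  walk-length : ∀ {v es vs} → WalkFrom G v es vs → length vs ≡ suc (length es)
  walk-length stop       = refl
  walk-length (step _ w) = cong suc (walk-length w)

  walk-step : ∀ (d : Fin n) (e₀ : Fin m) {v es vs} → WalkFrom G v es vs → ∀ {i} → suc i < length vs →
              Joins G (nth e₀ es i) (nth d vs i) (nth d vs (suc i))
  walk-step d e₀ stop                {_}     (s≤s ())
  walk-step d e₀ (step j stop)       {zero}  _         = j
  walk-step d e₀ (step j (step _ _)) {zero}  _         = j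
  walk-step d e₀ (step _ w)          {suc i} (s≤s i<n) = walk-step d e₀ w i<n

  incident? : ∀ e v → Dec (Incident G e v)
  incident? e v = (proj₁ (ends e) ≟ v) ⊎-dec (proj₂ (ends e) ≟ v)

  module _ (hes : List (Fin m)) where
    open import Data.List.Membership.DecPropositional (_≟_ {m}) using (_∈?_)

    countOutside-∈ : ∀ {e} es → e ∈ hes → countOutside G hes (e ∷ es) ≡ countOutside G hes es
    countOutside-∈ es e∈ = cong length (filter-reject (λ e → ¬? (e ∈? hes)) (λ e∉ → e∉ e∈))

    countOutside-∉ : ∀ {e} es → e ∉ hes → countOutside G hes (e ∷ es) ≡ suc (countOutside G hes es)
    countOutside-∉ es e∉ = cong length (filter-accept (λ e → ¬? (e ∈? hes)) e∉)

    off-path-edge : 0 < sizeM G hes → ∃ λ e → e ∉ hes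
    off-path-edge 0<|M| with nonempty⇒∈ 0<|M|
    ... | e , e∈M = e , proj₂ (∈-filter⁻ (λ e → ¬? (e ∈? hes)) {xs = allFin m} e∈M)

    one-edge-path : ∀ {k e} → k ≤ 1 → e ∉ hes → PathThroughM G hes k
    one-edge-path {e = e} k≤1 e∉ =
      e ∷ [] , proj₁ (ends e) ∷ proj₂ (ends e) ∷ [] ,
      ((proj₁ (ends e) , step (inj₁ refl) stop) , (loopless e ∷ []) ∷ [] ∷ []) ,
      ≤-trans k≤1 (≤-reflexive (sym (countOutside-∉ [] e∉)))

  unique-incident≤degree : ∀ {v es} → Unique es → All (λ e → Incident G e v) es → length es ≤ degree G v
  unique-incident≤degree {v} u inc =
    unique-⊆⇒length≤ _≟_ u (λ {e} e∈es → ∈-filter⁺ (λ e → incident? e v) (∈-allFin e) (All.lookup inc e∈es))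

module OnHamiltonianPath (G : Multigraph) (subcubic : Subcubic G)
  (hes : List (Fin (Multigraph.m G))) (hvs : List (Fin (Multigraph.n G)))
  (ham : IsHamiltonianPath G hes hvs) (e₀ : Fin (Multigraph.m G)) where

  open Multigraph G
  open Walks G
  open import Data.List.Membership.DecPropositional (_≟_ {m}) using (_∈?_)

  L : ℕ
  L = length hvs

  vertexAt : ℕ → Fin n
  vertexAt = nth (proj₁ (proj₁ (proj₁ ham))) hvs

  -- e₀ only serves as the value of nth past the end of hes
  edgeAt : ℕ → Fin m
  edgeAt = nth e₀ hes

  path-step : ∀ {i} → suc i < L → Joins G (edgeAt i) (vertexAt i) (vertexAt (suc i))
  path-step = walk-step _ e₀ (proj₂ (proj₁ (proj₁ ham)))

  path-edge : ∀ {i} → suc i < L → edgeAt i ∈ hes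
  path-edge {i} i+1<L = nth-∈ e₀ hes (≤-pred (subst (suc i <_) (walk-length (proj₂ (proj₁ (proj₁ ham)))) i+1<L))

  vertexAt-injective : ∀ {i j} → i < L → j < L → vertexAt i ≡ vertexAt j → i ≡ j
  vertexAt-injective = nth-injective _ (proj₂ (proj₁ ham))

  position : Fin n → ℕ
  position u = proj₁ (∈⇒nth (proj₁ (proj₁ (proj₁ ham))) (proj₂ ham u))

  position<L : ∀ u → position u < L
  position<L u = proj₁ (proj₂ (∈⇒nth (proj₁ (proj₁ (proj₁ ham))) (proj₂ ham u)))

  vertexAt-position : ∀ u → vertexAt (position u) ≡ u
  vertexAt-position u = proj₂ (proj₂ (∈⇒nth (proj₁ (proj₁ (proj₁ ham))) (proj₂ ham u)))

  Interior : ℕ → Set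
  Interior p = 0 < p × suc p < L

  interior? : Decidable Interior
  interior? p = (0 <? p) ×-dec (suc p <? L)

  -- the two path edges at an interior vertex together with two further edges would be four
  interior-meets-one : ∀ {p e e′} → Interior p → e ∉ hes → e′ ∉ hes →
                       Incident G e (vertexAt p) → Incident G e′ (vertexAt p) → e ≡ e′
  interior-meets-one {suc p} {e} {e′} (_ , p+2<L) e∉ e′∉ e-inc e′-inc with e ≟ e′
  ... | yes e≡e′ = e≡e′
  ... | no  e≢e′ = contradiction (≤-trans four≤degree (subcubic (vertexAt (suc p)))) (<-irrefl refl)
    where
      p+1<L = <-trans (n<1+n (suc p)) p+2<L
      p<L   = <-trans (n<1+n p) p+1<L
      before = path-step p+1<L
      after  = path-step p+2<L
      before≢after : edgeAt p ≢ edgeAt (suc p)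
      before≢after eq
        with Joins-twice before (subst (λ f → Joins G f (vertexAt (suc p)) (vertexAt (suc (suc p)))) (sym eq) after)
      ... | inj₁ x≡y        = <⇒≢ (n<1+n p) (vertexAt-injective p<L p+1<L x≡y)
      ... | inj₂ (inj₁ x≡z) = <⇒≢ (<-trans (n<1+n p) (n<1+n (suc p))) (vertexAt-injective p<L p+2<L x≡z)
      ... | inj₂ (inj₂ y≡z) = <⇒≢ (n<1+n (suc p)) (vertexAt-injective p+1<L p+2<L y≡z)
      apart : ∀ {f f′} → f ∈ hes → f′ ∉ hes → f ≢ f′
      apart f∈ f′∉ refl = f′∉ f∈
      four≤degree : 4 ≤ degree G (vertexAt (suc p))
      four≤degree = unique-incident≤degree
        ((before≢after ∷ apart (path-edge p+1<L) e∉ ∷ apart (path-edge p+1<L) e′∉ ∷ []) ∷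
         (apart (path-edge p+2<L) e∉ ∷ apart (path-edge p+2<L) e′∉ ∷ []) ∷ (e≢e′ ∷ []) ∷ [] ∷ [])
        (proj₂ (Joins⇒Incident before) ∷ proj₁ (Joins⇒Incident after) ∷ e-inc ∷ e′-inc ∷ [])

  OffPathAt : Fin n → Fin m → Set
  OffPathAt v e = e ∉ hes × Incident G e v

  offPathAt? : ∀ v → Decidable (OffPathAt v)
  offPathAt? v e = ¬? (e ∈? hes) ×-dec incident? e v

  end-meets-two : ∀ {v h} → h ∈ hes → Incident G h v → length (filter (offPathAt? v) (allFin m)) ≤ 2
  end-meets-two {v} h∈ h-inc = ≤-pred (≤-trans
    (unique-incident≤degree
      (All.tabulate (λ e∈ → λ h≡e → proj₁ (proj₂ (∈-filter⁻ (offPathAt? v) {xs = allFin m} e∈)) (subst (_∈ hes) h≡e h∈)) ∷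
       Unique.filter⁺ (offPathAt? v) (Unique.allFin⁺ m))
      (h-inc ∷ All.tabulate (λ e∈ → proj₂ (proj₂ (∈-filter⁻ (offPathAt? v) {xs = allFin m} e∈)))))
    (subcubic v))

  first last : Fin m → ℕ
  first e = position (proj₁ (ends e)) ⊓ position (proj₂ (ends e))
  last  e = position (proj₁ (ends e)) ⊔ position (proj₂ (ends e))

  ends-sorted : ∀ e → (first e ≡ position (proj₁ (ends e)) × last e ≡ position (proj₂ (ends e)))
                    ⊎ (first e ≡ position (proj₂ (ends e)) × last e ≡ position (proj₁ (ends e)))
  ends-sorted e with ≤-total (position (proj₁ (ends e))) (position (proj₂ (ends e)))
  ... | inj₁ u≤w = inj₁ (m≤n⇒m⊓n≡m u≤w , m≤n⇒m⊔n≡n u≤w)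
  ... | inj₂ w≤u = inj₂ (m≥n⇒m⊓n≡n w≤u , m≥n⇒m⊔n≡m w≤u)

  first<last : ∀ e → first e < last e
  first<last e = ≤∧≢⇒< (m⊓n≤m⊔n _ _) first≢last
    where
      positions-differ : position (proj₁ (ends e)) ≢ position (proj₂ (ends e))
      positions-differ eq = loopless e (trans (sym (vertexAt-position _)) (trans (cong vertexAt eq) (vertexAt-position _)))
      first≢last : first e ≢ last e
      first≢last eq with ends-sorted e
      ... | inj₁ (f≡u , l≡w) = positions-differ (trans (sym f≡u) (trans eq l≡w))
      ... | inj₂ (f≡w , l≡u) = positions-differ (sym (trans (sym f≡w) (trans eq l≡u)))

  joins-first-last : ∀ e → Joins G e (vertexAt (first e)) (vertexAt (last e))
  joins-first-last e with ends-sorted e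
  ... | inj₁ (f≡u , l≡w) = inj₁ (sym (cong₂ _,_ (trans (cong vertexAt f≡u) (vertexAt-position _))
                                                (trans (cong vertexAt l≡w) (vertexAt-position _))))
  ... | inj₂ (f≡w , l≡u) = inj₂ (sym (cong₂ _,_ (trans (cong vertexAt l≡u) (vertexAt-position _))
                                                (trans (cong vertexAt f≡w) (vertexAt-position _))))

  IsChord : Fin m → Set
  IsChord e = e ∉ hes × Interior (first e) × Interior (last e)

  isChord? : Decidable IsChord
  isChord? e = ¬? (e ∈? hes) ×-dec interior? (first e) ×-dec interior? (last e)

  Chord : Set
  Chord = Σ (Fin m) (True ∘ isChord?)

  chord-edge : Chord → Fin m
  chord-edge = proj₁

  isChord : ∀ c → IsChord (chord-edge c)
  isChord (_ , t) = toWitness t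

  chord-edge-injective : ∀ {c d} → chord-edge c ≡ chord-edge d → c ≡ d
  chord-edge-injective {e , t} {_ , t′} refl = cong (e ,_) (T-irrelevant t t′)

  lo hi : Chord → ℕ
  lo = first ∘ chord-edge
  hi = last ∘ chord-edge

  lo-injective : ∀ {c d} → lo c ≡ lo d → c ≡ d
  lo-injective {c} {d} eq = chord-edge-injective (interior-meets-one (proj₁ (proj₂ (isChord c)))
    (proj₁ (isChord c)) (proj₁ (isChord d)) (incident-lo c) (subst (λ p → Incident G _ (vertexAt p)) (sym eq) (incident-lo d)))
    where
      incident-lo : ∀ c → Incident G (chord-edge c) (vertexAt (lo c))
      incident-lo c = proj₁ (Joins⇒Incident (joins-first-last (chord-edge c)))

  hi-injective : ∀ {c d} → hi c ≡ hi d → c ≡ d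
  hi-injective {c} {d} eq = chord-edge-injective (interior-meets-one (proj₂ (proj₂ (isChord c)))
    (proj₁ (isChord c)) (proj₁ (isChord d)) (incident-hi c) (subst (λ p → Incident G _ (vertexAt p)) (sym eq) (incident-hi d)))
    where
      incident-hi : ∀ c → Incident G (chord-edge c) (vertexAt (hi c))
      incident-hi c = proj₂ (Joins⇒Incident (joins-first-last (chord-edge c)))

  hi<L : ∀ c → hi c < L
  hi<L c = <-trans (n<1+n _) (proj₂ (proj₂ (proj₂ (isChord c))))

  last<L : ∀ e → last e < L
  last<L e with ends-sorted e
  ... | inj₁ (_ , l≡w) = subst (_< L) (sym l≡w) (position<L _)
  ... | inj₂ (_ , l≡u) = subst (_< L) (sym l≡u) (position<L _)

  chordList : List Chord
  chordList = All.toList (All.map fromWitness (All.all-filter isChord? (allFin m)))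

  chordList-edges : map chord-edge chordList ≡ filter isChord? (allFin m)
  chordList-edges = toList-proj₁ (All.map fromWitness (All.all-filter isChord? (allFin m)))
    where
      toList-proj₁ : ∀ {P : Fin m → Set} {es} (pes : All P es) → map proj₁ (All.toList pes) ≡ es
      toList-proj₁ []         = refl
      toList-proj₁ (_ ∷ pes) = cong (_ ∷_) (toList-proj₁ pes)

  chordList-unique : Unique chordList
  chordList-unique = Unique.map⁻ (subst Unique (sym chordList-edges) (Unique.filter⁺ isChord? (Unique.allFin⁺ m)))

  length-chordList : length chordList ≡ length (filter isChord? (allFin m))
  length-chordList = trans (sym (length-map chord-edge chordList)) (cong length chordList-edges)

  -- off-path edges that are not chords touch an end of the path, which meets at most two of them
  module Ends (L′ : ℕ) (L≡ : L ≡ suc (suc L′)) where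

    boundary : ∀ {p} → p < L → ¬ Interior p → p ≡ 0 ⊎ p ≡ suc L′
    boundary {zero}  _   _        = inj₁ refl
    boundary {suc p} p<L ¬interior with suc (suc p) <? L
    ... | yes p+2<L = contradiction (s≤s z≤n , p+2<L) ¬interior
    ... | no  p+2≮L = inj₂ (≤-antisym (≤-pred (subst (suc p <_) L≡ p<L)) (≤-pred (subst (_≤ suc (suc p)) L≡ (≮⇒≥ p+2≮L))))

    AtEnd : Fin m → Set
    AtEnd e = OffPathAt (vertexAt 0) e ⊎ OffPathAt (vertexAt (suc L′)) e

    off-path : ∀ {e} → e ∉ hes → IsChord e ⊎ AtEnd e
    off-path {e} e∉ with interior? (first e) | interior? (last e)
    ... | yes first-in | yes last-in = inj₁ (e∉ , first-in , last-in)
    ... | no ¬first-in | _           = inj₂ (at-end (boundary (<-trans (first<last e) (last<L e)) ¬first-in)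
                                                     (proj₁ (Joins⇒Incident (joins-first-last e))))
      where
        at-end : ∀ {p} → p ≡ 0 ⊎ p ≡ suc L′ → Incident G e (vertexAt p) → AtEnd e
        at-end (inj₁ refl) inc = inj₁ (e∉ , inc)
        at-end (inj₂ refl) inc = inj₂ (e∉ , inc)
    ... | yes _        | no ¬last-in = inj₂ (at-end (boundary (last<L e) ¬last-in)
                                                     (proj₂ (Joins⇒Incident (joins-first-last e))))
      where
        at-end : ∀ {p} → p ≡ 0 ⊎ p ≡ suc L′ → Incident G e (vertexAt p) → AtEnd e
        at-end (inj₁ refl) inc = inj₁ (e∉ , inc)
        at-end (inj₂ refl) inc = inj₂ (e∉ , inc)

    sizeM≤ : sizeM G hes ≤ length chordList + 4
    sizeM≤ = begin
      sizeM G hes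
        ≤⟨ length-filter-⊎ _ isChord? atEnd? off-path (allFin m) ⟩
      length (filter isChord? (allFin m)) + length (filter atEnd? (allFin m))
        ≤⟨ +-monoʳ-≤ _ (length-filter-⊎ atEnd? (offPathAt? (vertexAt 0)) (offPathAt? (vertexAt (suc L′))) (λ x → x) (allFin m)) ⟩
      length (filter isChord? (allFin m)) + (length (filter (offPathAt? (vertexAt 0)) (allFin m))
                                              + length (filter (offPathAt? (vertexAt (suc L′))) (allFin m)))
        ≤⟨ +-mono-≤ (≤-reflexive (sym length-chordList))
                    (+-mono-≤ (end-meets-two (path-edge 1<L) (proj₁ (Joins⇒Incident (path-step 1<L))))
                              (end-meets-two (path-edge L′+1<L) (proj₂ (Joins⇒Incident (path-step L′+1<L))))) ⟩
      length chordList + 4 ∎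
      where
        open ≤-Reasoning
        atEnd? : Decidable AtEnd
        atEnd? e = offPathAt? (vertexAt 0) e ⊎-dec offPathAt? (vertexAt (suc L′)) e
        1<L : 1 < L
        1<L = subst (1 <_) (sym L≡) (s≤s (s≤s z≤n))
        L′+1<L : suc L′ < L
        L′+1<L = subst (suc L′ <_) (sym L≡) ≤-refl

  open Routes lo hi

  edgesOf : ∀ {x} → Route x → List (Fin m)
  edgesOf (stop _)       = []
  edgesOf {x} (up r)     = edgeAt x ∷ edgesOf r
  edgesOf (down {x} r)   = edgeAt x ∷ edgesOf r
  edgesOf (chord⁺ c _ r) = chord-edge c ∷ edgesOf r
  edgesOf (chord⁻ c _ r) = chord-edge c ∷ edgesOf r

  route-walk : ∀ {x} (r : Route x) → All (_< L) (visits r) →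
               WalkFrom G (vertexAt x) (edgesOf r) (map vertexAt (visits r))
  route-walk (stop _)          _              = stop
  route-walk (up r)            (_ ∷ in-r)     = step (path-step (head-visits r in-r)) (route-walk r in-r)
  route-walk (down r)          (x+1<L ∷ in-r) = step (Joins-sym (path-step x+1<L)) (route-walk r in-r)
  route-walk (chord⁺ c refl r) (_ ∷ in-r)     = step (joins-first-last (chord-edge c)) (route-walk r in-r)
  route-walk (chord⁻ c refl r) (_ ∷ in-r)     = step (Joins-sym (joins-first-last (chord-edge c))) (route-walk r in-r)

  count-on-path : ∀ {e es k} → e ∈ hes → k ≤ countOutside G hes es → k ≤ countOutside G hes (e ∷ es)
  count-on-path {es = es} e∈ = subst (_ ≤_) (sym (countOutside-∈ hes es e∈))

  count-chord : ∀ c {es k} → k ≤ countOutside G hes es → suc k ≤ countOutside G hes (chord-edge c ∷ es)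
  count-chord c {es} k≤ = subst (_ ≤_) (sym (countOutside-∉ hes es (proj₁ (isChord c)))) (s≤s k≤)

  route-count : ∀ {x} (r : Route x) → All (_< L) (visits r) → chords r ≤ countOutside G hes (edgesOf r)
  route-count (stop _)       _              = z≤n
  route-count (up r)         (_ ∷ in-r)     = count-on-path (path-edge (head-visits r in-r)) (route-count r in-r)
  route-count (down r)       (x+1<L ∷ in-r) = count-on-path (path-edge x+1<L) (route-count r in-r)
  route-count (chord⁺ c _ r) (_ ∷ in-r)     = count-chord c (route-count r in-r)
  route-count (chord⁻ c _ r) (_ ∷ in-r)     = count-chord c (route-count r in-r)

  map-vertexAt-unique : ∀ {xs} → Unique xs → All (_< L) xs → Unique (map vertexAt xs)
  map-vertexAt-unique []         []           = []
  map-vertexAt-unique (x∉ ∷ u) (x<L ∷ xs<L) = apart x<L x∉ xs<L ∷ map-vertexAt-unique u xs<L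
    where
      apart : ∀ {x ys} → x < L → All (x ≢_) ys → All (_< L) ys → All (vertexAt x ≢_) (map vertexAt ys)
      apart _   []             []           = []
      apart x<L (x≢y ∷ x≢ys) (y<L ∷ ys<L) = (λ eq → x≢y (vertexAt-injective x<L y<L eq)) ∷ apart x<L x≢ys ys<L

  route⇒path : ∀ {k} → SimpleRoute L k → PathThroughM G hes k
  route⇒path (x , r , distinct , in-path , k≤) =
    edgesOf r , map vertexAt (visits r) ,
    ((vertexAt x , route-walk r in-path) , map-vertexAt-unique distinct in-path) ,
    ≤-trans k≤ (route-count r in-path)

quadratic-bound : ∀ i F → 8 * (suc (suc i) * suc i) + 3 ≤ 3 * (F + 4) → 8 * (suc i * suc i) < 3 * F
quadratic-bound zero    F h = *-monoʳ-≤ 3 (+-cancelʳ-≤ 4 3 F (*-cancelˡ-< 3 6 (F + 4) h))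
quadratic-bound (suc i) F h = +-cancelʳ-≤ 12 _ (3 * F) (begin
  suc (8 * (j * j)) + 12                  ≤⟨ m≤m+n _ (8 * i + 6) ⟩
  suc (8 * (j * j)) + 12 + (8 * i + 6)    ≡⟨ expand i ⟩
  8 * (suc j * j) + 3                     ≤⟨ h ⟩
  3 * (F + 4)                             ≡⟨ *-distribˡ-+ 3 F 4 ⟩
  3 * F + 12                              ∎)
  where
    open ≤-Reasoning
    j = suc (suc i)
    expand : ∀ i → suc (8 * (suc (suc i) * suc (suc i))) + 12 + (8 * i + 6) ≡ 8 * (suc (suc (suc i)) * suc (suc i)) + 3
    expand = solve-∀

many-chords-path : ∀ {G} → Subcubic G → ∀ {hes hvs} → IsHamiltonianPath G hes hvs → ∀ i {e₀} → e₀ ∉ hes →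
                   8 * (suc (suc i) * suc i) + 3 ≤ 3 * sizeM G hes → PathThroughM G hes (suc (suc i))
many-chords-path {G} subcubic {hes} {hvs} ham i {e₀} _ bound =
  route⇒path (chord-route (suc i) chordList chordList-unique
    (quadratic-bound i (length chordList) (≤-trans bound (*-monoʳ-≤ 3 sizeM≤))))
  where
    open OnHamiltonianPath G subcubic hes hvs ham e₀
    open ManyChords lo hi (first<last ∘ chord-edge) L hi<L lo-injective hi-injective
    2≤L : 2 ≤ L
    2≤L = ≤-trans (s≤s (s≤s z≤n)) (<-≤-trans (s≤s (first<last e₀)) (last<L e₀))
    open Ends (L ∸ 2) (sym (m+[n∸m]≡n 2≤L))

lemma3p1 : (k : ℕ) (G : Multigraph) → Subcubic G →
    (hes : List (Fin (Multigraph.m G))) (hvs : List (Fin (Multigraph.n G))) →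
    IsHamiltonianPath G hes hvs →
    8 * (k * (k ∸ 1)) + 3 ≤ 3 * sizeM G hes →
    Σ (List (Fin (Multigraph.m G))) (λ pes → Σ (List (Fin (Multigraph.n G))) (λ pvs →
    IsPath G pes pvs × k ≤ countOutside G hes pes))
lemma3p1 k G subcubic hes hvs ham bound
  with Walks.off-path-edge G hes (*-cancelˡ-< 3 0 _ (≤-trans (s≤s z≤n) (≤-trans (m≤n+m 3 _) bound)))
... | e , e∉ with k
...   | zero        = Walks.one-edge-path G hes z≤n e∉
...   | suc zero    = Walks.one-edge-path G hes ≤-refl e∉
...   | suc (suc i) = many-chords-path subcubic ham i e∉ bound
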